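{- There are instances of the Graph Reconstruction problem (hidden graphs on $n$ vertices, for each $n$) that take $\Omega(n)$ MIS queries to solve but can be solved with $\mathcal{O}(\log n)$ CC queries.
   Context: Graph Reconstruction (GR): an unknown ("hidden") simple undirected graph $G=(V,E)$ on a known vertex set $V$ with $|V|=n$ is to be determined, i.e. the algorithm must output $E$, using oracle queries; complexity is the number of queries. A CC oracle, on query $S\subseteq V$, returns the partition of $S$ into the vertex sets of the connected components of the induced subgraph $G[S]$. A maximal independent set (MIS) oracle, on query $S\subseteq V$, returns some maximal independent set of $G[S]$, which may be chosen adversarially among all maximal independent sets of $G[S]$. -}

module Defs where

open import Data.Nat using (ℕ; zero; suc; _≤_; _*_)
open import Data.Nat.Logarithm using (⌊log₂_⌋)
open import Data.Bool using (Bool; true; false)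
open import Data.Fin using (Fin)
open import Data.Fin.Subset using (Subset; _∈_; _∉_; _⊆_)
open import Data.Product using (Σ; ∃; _×_)
open import Relation.Binary.PropositionalEquality using (_≡_)
open import Function.Bundles using (_⇔_)

record Graph (n : ℕ) : Set where
  field
    adj     : Fin n → Fin n → Bool
    sym     : ∀ u v → adj u v ≡ adj v u
    irrefl  : ∀ v → adj v v ≡ false
open Graph public

-- A class of hidden graphs ("instance" of GR): for each n a set of graphs on n vertices.
GraphClass : Set₁
GraphClass = (n : ℕ) → Graph n → Set

-- Deterministic adaptive query algorithms as decision trees:
-- query type Q, answer type A, output type O.
data Tree (Q A O : Set) : Set where
  leaf : O → Tree Q A O
  ask  : Q → (A → Tree Q A O) → Tree Q A O

data Exec {Q A O : Set} (R : Q → A → Set) : Tree Q A O → O → ℕ → Set where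
  done : ∀ {o} → Exec R (leaf o) o 0
  step : ∀ {q f a o k} → R q a → Exec R (f a) o k → Exec R (ask q f) o (suc k)

EdgeSet : ℕ → Set
EdgeSet n = Fin n → Fin n → Bool

Oracle : ℕ → Set → Set → Set₁
Oracle n Q A = Graph n → Q → A → Set

-- T reconstructs every graph of class C on n vertices using at most k queries,
-- for every admissible (possibly adversarial) sequence of oracle answers.
SolvesWithin : ∀ {Q A} (n : ℕ) → Oracle n Q A → GraphClass →
               Tree Q A (EdgeSet n) → ℕ → Set
SolvesWithin n O C T k =
  ∀ (G : Graph n) → C n G → ∀ (E : EdgeSet n) (m : ℕ) → Exec (O G) T E m →
  (∀ u v → E u v ≡ adj G u v) × m ≤ k

data Reach {n : ℕ} (G : Graph n) (S : Subset n) : Fin n → Fin n → Set where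
  here  : ∀ {u} → u ∈ S → Reach G S u u
  there : ∀ {u w v} → Reach G S u w → adj G w v ≡ true → v ∈ S → Reach G S u v

-- The partition of S into connected components of G[S] is encoded by its
-- "same component" relation on S (false outside S).
CCAnswer : ℕ → Set
CCAnswer n = Fin n → Fin n → Bool

CC : (n : ℕ) → Oracle n (Subset n) (CCAnswer n)
CC n G S P = ∀ u v → (P u v ≡ true) ⇔ Reach G S u v

-- MIS oracle (adversarial: any maximal independent set of G[S] is admissible)

IsMIS : ∀ {n} → Graph n → Subset n → Subset n → Set
IsMIS {n} G S I =
  I ⊆ S ×
  (∀ {u v} → u ∈ I → v ∈ I → adj G u v ≡ false) ×
  (∀ {v} → v ∈ S → v ∉ I → Σ (Fin n) λ u → u ∈ I × adj G u v ≡ true)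

MIS : (n : ℕ) → Oracle n (Subset n) (Subset n)
MIS n G S I = IsMIS G S I

-- The hidden graphs are the disjoint unions of (at most) two cliques, coded by
-- a colouring f : Fin n → Bool with u ~ v iff u ≠ v and f u = f v.  A single CC
-- query on the whole vertex set returns the two cliques, hence every edge.
--
-- Against MIS queries an adversary maintains a colouring g and a list L of
-- committed vertices, and answers every query S with a set that is a maximal
-- independent set of G_f[S] for every f agreeing with g on L, at the price of
-- committing at most two new vertices: if at most one vertex x of S is
-- uncommitted, it commits x and answers as for g; otherwise it commits two
-- uncommitted vertices of S with opposite colours and answers with that pair.
-- Flipping the colour of a vertex z that is still uncommitted at the end
-- changes the edge between z and any other vertex but not the run, so a correct
-- algorithm forces all n vertices to be committed and asks at least n/2 queries.
module Submission where

open import Defs hiding (sym)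
open import Data.Nat using (ℕ; _≤_; _*_; _+_; suc; s≤s)
open import Data.Nat.Logarithm using (⌊log₂_⌋; ⌊log₂⌋-mono-≤)
open import Data.Nat.Properties
  using (≤-refl; ≤-reflexive; ≤-trans; +-monoˡ-≤; +-assoc; +-comm; m≤m+n; n≤1+n;
         ≮⇒≥; *-monoˡ-≤; *-comm; *-identityˡ; module ≤-Reasoning)
open import Data.Bool using (Bool; true; false; not; _∧_; T)
open import Data.Bool.Properties using (T-≡; not-¬; ¬-not) renaming (_≟_ to _≟ᵇ_)
open import Data.Fin using (Fin; zero; suc)
open import Data.Fin.Properties using (_≟_; any?; pigeonhole; <-irrefl)
open import Data.Fin.Subset using (Subset; _∈_; _∉_; _⊆_; ⁅_⁆; _∪_; ⊤; ⊥)
open import Data.Fin.Subset.Properties using (_∈?_; ∈⊤; ∉⊥; x∈⁅x⁆; x∈⁅y⁆⇒x≡y; x∈p∪q⁻; x∈p∪q⁺)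
open import Data.List using (List; []; _∷_; length; lookup)
open import Data.List.Relation.Unary.All as All using (All; []; _∷_)
open import Data.List.Relation.Unary.Any using (here; there; index)
open import Data.List.Relation.Unary.Any.Properties using (lookup-index)
open import Data.List.Membership.Propositional using () renaming (_∈_ to _∈ₗ_; _∉_ to _∉ₗ_)
import Data.List.Membership.DecPropositional as DecMembership
open import Data.Product using (Σ; ∃; _×_; _,_; proj₁; proj₂)
open import Data.Sum using (_⊎_; inj₁; inj₂)
import Data.Sum as Sum
open import Data.Empty using (⊥-elim)
open import Function using (const; _∘_)
open import Function.Bundles using (Equivalence; mk⇔)
open import Data.Vec.Functional using (updateAt)
open import Data.Vec.Functional.Properties using (updateAt-updates; updateAt-minimal)
open import Relation.Nullary using (Dec; yes; no; does; ¬?; _×-dec_; T?)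
open import Relation.Nullary.Decidable using (dec-true; dec-false; does-⇔; decidable-stable)
open import Relation.Binary.PropositionalEquality
  using (_≡_; _≢_; refl; sym; trans; cong; cong₂; subst; ≢-sym; module ≡-Reasoning)

private
  variable
    n : ℕ

_∈ₗ?_ : (v : Fin n) (L : List (Fin n)) → Dec (v ∈ₗ L)
v ∈ₗ? L = DecMembership._∈?_ _≟_ v L

does-true⇒ : ∀ {A : Set} (a? : Dec A) → does a? ≡ true → A
does-true⇒ (yes a) _ = a

does-≟ᵇ-not : ∀ a b → does (a ≟ᵇ not b) ≡ not (does (a ≟ᵇ b))
does-≟ᵇ-not false false = refl
does-≟ᵇ-not false true  = refl
does-≟ᵇ-not true  false = refl
does-≟ᵇ-not true  true  = refl

Fin-≢-exists : 2 ≤ n → (z : Fin n) → ∃ λ w → w ≢ z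
Fin-≢-exists (s≤s (s≤s _)) zero    = suc zero , λ ()
Fin-≢-exists (s≤s (s≤s _)) (suc z) = zero , λ ()

n≤length-of-cover : (L : List (Fin n)) → (∀ z → z ∈ₗ L) → n ≤ length L
n≤length-of-cover L cover = ≮⇒≥ λ length<n →
  let i , j , i<j , same-index = pigeonhole length<n (λ z → index (cover z))
      i≡j = trans (lookup-index (cover i))
                  (trans (cong (lookup L) same-index) (sym (lookup-index (cover j))))
  in <-irrefl i≡j i<j

SolvesWithin-mono : ∀ {Q A} {O : Oracle n Q A} {C : GraphClass} {T : Tree Q A (EdgeSet n)} {k k′} →
                    k ≤ k′ → SolvesWithin n O C T k → SolvesWithin n O C T k′
SolvesWithin-mono k≤k′ solves G G∈C E m run =
  proj₁ (solves G G∈C E m run) , ≤-trans (proj₂ (solves G G∈C E m run)) k≤k′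

Reach-preserves : ∀ {A : Set} {G : Graph n} {S u v} (c : Fin n → A) →
                  (∀ {x y} → adj G x y ≡ true → c x ≡ c y) → Reach G S u v → c u ≡ c v
Reach-preserves c preserves (here _)      = refl
Reach-preserves c preserves (there r e _) = trans (Reach-preserves c preserves r) (preserves e)

IsMIS-resp : ∀ {G H : Graph n} {S I} → (∀ {u v} → u ∈ S → v ∈ S → adj G u v ≡ adj H u v) →
             IsMIS G S I → IsMIS H S I
IsMIS-resp G≗H (I⊆S , independent , maximal) =
  I⊆S ,
  (λ u∈I v∈I → trans (sym (G≗H (I⊆S u∈I) (I⊆S v∈I))) (independent u∈I v∈I)) ,
  λ v∈S v∉I → let u , u∈I , uv = maximal v∈S v∉I
              in u , u∈I , trans (sym (G≗H (I⊆S u∈I) v∈S)) uv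

CliqueEdge : (Fin n → Bool) → Fin n → Fin n → Set
CliqueEdge f u v = u ≢ v × f u ≡ f v

cliqueEdge? : (f : Fin n → Bool) (u v : Fin n) → Dec (CliqueEdge f u v)
cliqueEdge? f u v = ¬? (u ≟ v) ×-dec (f u ≟ᵇ f v)

twoCliques : (Fin n → Bool) → Graph n
twoCliques f = record
  { adj    = λ u v → does (cliqueEdge? f u v)
  ; sym    = λ u v → does-⇔ (mk⇔ swap swap) (cliqueEdge? f u v) (cliqueEdge? f v u)
  ; irrefl = λ v → dec-false (cliqueEdge? f v v) λ (v≢v , _) → v≢v refl
  }
  where
  swap : ∀ {u v} → CliqueEdge f u v → CliqueEdge f v u
  swap (u≢v , fu≡fv) = ≢-sym u≢v , sym fu≡fv

TwoCliqueGraphs : GraphClass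
TwoCliqueGraphs n G = ∃ λ (f : Fin n → Bool) → ∀ u v → adj G u v ≡ adj (twoCliques f) u v

twoCliques-adj-≢ : ∀ (f : Fin n → Bool) {u v} → u ≢ v → adj (twoCliques f) u v ≡ does (f u ≟ᵇ f v)
twoCliques-adj-≢ f {u} {v} u≢v rewrite dec-false (u ≟ v) u≢v = refl

twoCliques-adj-cong : ∀ {f g : Fin n → Bool} u v → f u ≡ g u → f v ≡ g v →
                      adj (twoCliques f) u v ≡ adj (twoCliques g) u v
twoCliques-adj-cong u v = cong₂ λ a b → not (does (u ≟ v)) ∧ does (a ≟ᵇ b)

twoCliques-adj-flip : ∀ (f : Fin n → Bool) {w z} → w ≢ z →
                      adj (twoCliques f) w z ≢ adj (twoCliques (updateAt f z not)) w z
twoCliques-adj-flip f {w} {z} w≢z same = not-¬ refl (begin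
  does (f w ≟ᵇ f z)               ≡⟨ sym (twoCliques-adj-≢ f w≢z) ⟩
  adj (twoCliques f) w z          ≡⟨ same ⟩
  adj (twoCliques f′) w z         ≡⟨ twoCliques-adj-≢ f′ w≢z ⟩
  does (f′ w ≟ᵇ f′ z)             ≡⟨ cong₂ (λ a b → does (a ≟ᵇ b))
                                           (updateAt-minimal w z f w≢z) (updateAt-updates z f) ⟩
  does (f w ≟ᵇ not (f z))         ≡⟨ does-≟ᵇ-not (f w) (f z) ⟩
  not (does (f w ≟ᵇ f z))         ∎)
  where
  open ≡-Reasoning
  f′ : Fin _ → Bool
  f′ = updateAt f z not

module _ {G : Graph n} {f : Fin n → Bool} (G≗f : ∀ u v → adj G u v ≡ adj (twoCliques f) u v) where

  Reach⇒sameColour : ∀ {S u v} → Reach G S u v → f u ≡ f v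
  Reach⇒sameColour = Reach-preserves f λ {x} {y} e →
    proj₂ (does-true⇒ (cliqueEdge? f x y) (trans (sym (G≗f x y)) e))

  sameColour⇒Reach : ∀ {u v} → f u ≡ f v → Reach G ⊤ u v
  sameColour⇒Reach {u} {v} fu≡fv with u ≟ v
  ... | yes refl = here ∈⊤
  ... | no u≢v   = there (here ∈⊤) (trans (G≗f u v) (dec-true (cliqueEdge? f u v) (u≢v , fu≡fv))) ∈⊤

  CC-⊤-sameColour : ∀ {P} → CC n G ⊤ P → ∀ u v → P u v ≡ does (f u ≟ᵇ f v)
  CC-⊤-sameColour {P} cc u v = does-⇔ (mk⇔ to from) (T? (P u v)) (f u ≟ᵇ f v)
    where
    to : T (P u v) → f u ≡ f v
    to t = Reach⇒sameColour (Equivalence.to (cc u v) (Equivalence.to T-≡ t))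
    from : f u ≡ f v → T (P u v)
    from fu≡fv = Equivalence.from T-≡ (Equivalence.from (cc u v) (sameColour⇒Reach fu≡fv))

ccReconstruct : ∀ n → Tree (Subset n) (CCAnswer n) (EdgeSet n)
ccReconstruct n = ask ⊤ λ P → leaf λ u v → not (does (u ≟ v)) ∧ P u v

ccReconstruct-solves : SolvesWithin n (CC n) TwoCliqueGraphs (ccReconstruct n) 1
ccReconstruct-solves G (f , G≗f) E m (step {a = P} cc done) = reconstructs , ≤-refl
  where
  reconstructs : ∀ u v → not (does (u ≟ v)) ∧ P u v ≡ adj G u v
  reconstructs u v =
    trans (cong (not (does (u ≟ v)) ∧_) (CC-⊤-sameColour {f = f} G≗f cc u v)) (sym (G≗f u v))

∈-pair⁻ : ∀ {x y u : Fin n} → u ∈ ⁅ x ⁆ ∪ ⁅ y ⁆ → u ≡ x ⊎ u ≡ y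
∈-pair⁻ {x = x} {y} u∈ = Sum.map (x∈⁅y⁆⇒x≡y x) (x∈⁅y⁆⇒x≡y y) (x∈p∪q⁻ ⁅ x ⁆ ⁅ y ⁆ u∈)

transversal⇒IsMIS : ∀ (f : Fin n → Bool) {S I} → I ⊆ S →
                    (∀ {u v} → u ∈ I → v ∈ I → f u ≡ f v → u ≡ v) →
                    (∀ {v} → v ∈ S → ∃ λ u → u ∈ I × f u ≡ f v) →
                    IsMIS (twoCliques f) S I
transversal⇒IsMIS f I⊆S injective covering = I⊆S , independent , maximal
  where
  independent : ∀ {u v} → u ∈ _ → v ∈ _ → adj (twoCliques f) u v ≡ false
  independent {u} {v} u∈I v∈I =
    dec-false (cliqueEdge? f u v) λ (u≢v , fu≡fv) → u≢v (injective u∈I v∈I fu≡fv)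
  maximal : ∀ {v} → v ∈ _ → v ∉ _ → ∃ λ u → u ∈ _ × adj (twoCliques f) u v ≡ true
  maximal {v} v∈S v∉I =
    let u , u∈I , fu≡fv = covering v∈S
    in u , u∈I , dec-true (cliqueEdge? f u v) ((λ u≡v → v∉I (subst (_∈ _) u≡v u∈I)) , fu≡fv)

pair-IsMIS : ∀ (f : Fin n → Bool) {S x y} → x ∈ S → y ∈ S → f x ≢ f y →
             IsMIS (twoCliques f) S (⁅ x ⁆ ∪ ⁅ y ⁆)
pair-IsMIS f {S} {x} {y} x∈S y∈S fx≢fy = transversal⇒IsMIS f pair⊆S injective covering
  where
  x∈pair : x ∈ ⁅ x ⁆ ∪ ⁅ y ⁆
  x∈pair = x∈p∪q⁺ (inj₁ (x∈⁅x⁆ x))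
  y∈pair : y ∈ ⁅ x ⁆ ∪ ⁅ y ⁆
  y∈pair = x∈p∪q⁺ (inj₂ (x∈⁅x⁆ y))
  pair⊆S : ⁅ x ⁆ ∪ ⁅ y ⁆ ⊆ S
  pair⊆S u∈ with ∈-pair⁻ u∈
  ... | inj₁ refl = x∈S
  ... | inj₂ refl = y∈S
  injective : ∀ {u v} → u ∈ ⁅ x ⁆ ∪ ⁅ y ⁆ → v ∈ ⁅ x ⁆ ∪ ⁅ y ⁆ → f u ≡ f v → u ≡ v
  injective u∈ v∈ fu≡fv with ∈-pair⁻ u∈ | ∈-pair⁻ v∈
  ... | inj₁ refl | inj₁ refl = refl
  ... | inj₁ refl | inj₂ refl = ⊥-elim (fx≢fy fu≡fv)
  ... | inj₂ refl | inj₁ refl = ⊥-elim (fx≢fy (sym fu≡fv))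
  ... | inj₂ refl | inj₂ refl = refl
  covering : ∀ {v} → v ∈ S → ∃ λ u → u ∈ ⁅ x ⁆ ∪ ⁅ y ⁆ × f u ≡ f v
  covering {v} _ with f v ≟ᵇ f x
  ... | yes fv≡fx = x , x∈pair , sym fv≡fx
  ... | no fv≢fx  = y , y∈pair , trans (¬-not (≢-sym fx≢fy)) (sym (¬-not fv≢fx))

twoCliques-hasMIS : ∀ (f : Fin n → Bool) S → ∃ λ I → IsMIS (twoCliques f) S I
twoCliques-hasMIS f S with any? (_∈? S)
... | no S-empty = ⊥ , transversal⇒IsMIS f (λ u∈⊥ → ⊥-elim (∉⊥ u∈⊥)) (λ u∈⊥ → ⊥-elim (∉⊥ u∈⊥))
                         (λ v∈S → ⊥-elim (S-empty (_ , v∈S)))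
... | yes (x , x∈S) with any? (λ y → y ∈? S ×-dec ¬? (f x ≟ᵇ f y))
...   | yes (y , y∈S , fx≢fy) = ⁅ x ⁆ ∪ ⁅ y ⁆ , pair-IsMIS f x∈S y∈S fx≢fy
...   | no monochromatic = ⁅ x ⁆ , transversal⇒IsMIS f
          (λ u∈ → subst (_∈ S) (sym (x∈⁅y⁆⇒x≡y x u∈)) x∈S)
          (λ u∈ v∈ _ → trans (x∈⁅y⁆⇒x≡y x u∈) (sym (x∈⁅y⁆⇒x≡y x v∈)))
          (λ {v} v∈S → x , x∈⁅x⁆ x ,
                       decidable-stable (f x ≟ᵇ f v) (λ fx≢fv → monochromatic (v , v∈S , fx≢fv)))

AgreeOn : List (Fin n) → (Fin n → Bool) → (Fin n → Bool) → Set
AgreeOn L f g = All (λ v → f v ≡ g v) L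

AgreeOn-refl : ∀ (L : List (Fin n)) {f} → AgreeOn L f f
AgreeOn-refl L = All.tabulate λ _ → refl

AgreeOn-trans : ∀ {L : List (Fin n)} {f g h} → AgreeOn L f g → AgreeOn L g h → AgreeOn L f h
AgreeOn-trans f≗g g≗h = All.zipWith (λ (p , q) → trans p q) (f≗g , g≗h)

AgreeOn-updateAt : ∀ {L : List (Fin n)} {z} (g : Fin n → Bool) {h} → z ∉ₗ L → AgreeOn L (updateAt g z h) g
AgreeOn-updateAt {z = z} g z∉L = All.tabulate λ {v} v∈L → updateAt-minimal v z g λ { refl → z∉L v∈L }

⊆ₗ-or-outside : ∀ (S : Subset n) L → (∀ {v} → v ∈ S → v ∈ₗ L) ⊎ ∃ λ v → v ∈ S × v ∉ₗ L
⊆ₗ-or-outside S L with any? (λ v → v ∈? S ×-dec ¬? (v ∈ₗ? L))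
... | yes outside = inj₂ outside
... | no none     = inj₁ λ {v} v∈S → decidable-stable (v ∈ₗ? L) λ v∉L → none (v , v∈S , v∉L)

-- An adversary state (g, L) stands for the colourings that agree with g on the
-- committed vertices L; Forces g L k P says that by committing at most k more
-- vertices the adversary reaches a state all of whose colourings satisfy P.
record Forces (g : Fin n → Bool) (L : List (Fin n)) (k : ℕ) (P : (Fin n → Bool) → Set) : Set where
  constructor forcing
  field
    colouring  : Fin n → Bool
    committed  : List (Fin n)
    growth     : length committed ≤ length L + k
    consistent : ∀ f → AgreeOn committed f colouring → AgreeOn L f g × P f
open Forces

Forces-compose : ∀ {g : Fin n → Bool} {L a b P Q R} (r : Forces g L a P) →
                 Forces (colouring r) (committed r) b Q → (∀ {f} → P f → Q f → R f) →
                 Forces g L (a + b) R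
Forces-compose {g = g} {L} {a} {b} {R = R} r r′ combine =
  forcing (colouring r′) (committed r′) growth′ consistent′
  where
  open ≤-Reasoning
  growth′ : length (committed r′) ≤ length L + (a + b)
  growth′ = begin
    length (committed r′)      ≤⟨ growth r′ ⟩
    length (committed r) + b   ≤⟨ +-monoˡ-≤ b (growth r) ⟩
    length L + a + b           ≡⟨ +-assoc (length L) a b ⟩
    length L + (a + b)         ∎
  consistent′ : ∀ f → AgreeOn (committed r′) f (colouring r′) → AgreeOn L f g × R f
  consistent′ f agree =
    let agree′ , q = consistent r′ f agree
        agreeL , p = consistent r f agree′
    in agreeL , combine p q

determinedMIS : ∀ (g : Fin n → Bool) L S → (∀ {v} → v ∈ S → v ∈ₗ L) →
                ∃ λ I → ∀ f → AgreeOn L f g → IsMIS (twoCliques f) S I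
determinedMIS g L S S⊆L with twoCliques-hasMIS g S
... | I , mis = I , λ f f≗g → IsMIS-resp {G = twoCliques g} {twoCliques f} (same-on-S f≗g) mis
  where
  same-on-S : ∀ {f} → AgreeOn L f g → ∀ {u v} → u ∈ S → v ∈ S →
              adj (twoCliques g) u v ≡ adj (twoCliques f) u v
  same-on-S f≗g {u} {v} u∈S v∈S =
    sym (twoCliques-adj-cong u v (All.lookup f≗g (S⊆L u∈S)) (All.lookup f≗g (S⊆L v∈S)))

misAdversaryStep : ∀ (g : Fin n → Bool) L S → ∃ λ I → Forces g L 2 (λ f → IsMIS (twoCliques f) S I)
misAdversaryStep g L S with ⊆ₗ-or-outside S L
... | inj₁ S⊆L =
  let I , mis = determinedMIS g L S S⊆L
  in I , forcing g L (m≤m+n _ 2) λ f f≗g → f≗g , mis f f≗g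
... | inj₂ (x , x∈S , x∉L) with ⊆ₗ-or-outside S (x ∷ L)
...   | inj₁ S⊆x∷L =
  let I , mis = determinedMIS g (x ∷ L) S S⊆x∷L
  in I , forcing g (x ∷ L) (≤-trans (n≤1+n _) (≤-reflexive (+-comm 2 (length L))))
                 λ { f f≗g@(_ ∷ f≗gOnL) → f≗gOnL , mis f f≗g }
...   | inj₂ (y , y∈S , y∉x∷L) =
  ⁅ x ⁆ ∪ ⁅ y ⁆ , forcing g′ (y ∷ x ∷ L) (≤-reflexive (+-comm 2 (length L))) consistent′
  where
  g′ : Fin _ → Bool
  g′ = updateAt g y (const (not (g x)))
  x≢y : x ≢ y
  x≢y x≡y = y∉x∷L (here (sym x≡y))
  consistent′ : ∀ f → AgreeOn (y ∷ x ∷ L) f g′ → AgreeOn L f g × IsMIS (twoCliques f) S (⁅ x ⁆ ∪ ⁅ y ⁆)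
  consistent′ f (fy≡g′y ∷ fx≡g′x ∷ f≗g′) =
    AgreeOn-trans f≗g′ (AgreeOn-updateAt g (y∉x∷L ∘ there)) ,
    pair-IsMIS f x∈S y∈S λ fx≡fy → not-¬ refl (begin
      g x        ≡⟨ sym (updateAt-minimal x y g x≢y) ⟩
      g′ x       ≡⟨ sym fx≡g′x ⟩
      f x        ≡⟨ fx≡fy ⟩
      f y        ≡⟨ fy≡g′y ⟩
      g′ y       ≡⟨ updateAt-updates y g ⟩
      not (g x)  ∎)
    where open ≡-Reasoning

MISRun : Tree (Subset n) (Subset n) (EdgeSet n) → EdgeSet n → ℕ → (Fin n → Bool) → Set
MISRun {n} T E m f = Exec (MIS n (twoCliques f)) T E m

misAdversary : ∀ (T : Tree (Subset n) (Subset n) (EdgeSet n)) g L →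
               ∃ λ E → ∃ λ m → Forces g L (m * 2) (MISRun T E m)
misAdversary (leaf E)  g L = E , 0 , forcing g L (m≤m+n _ 0) λ f f≗g → f≗g , done
misAdversary (ask S h) g L =
  let I , r       = misAdversaryStep g L S
      E , m , r′ = misAdversary (h I) (colouring r) (committed r)
  in E , suc m , Forces-compose r r′ step

forcedRun-correct : ∀ {T : Tree (Subset n) (Subset n) (EdgeSet n)} {k g L c E m} →
                    SolvesWithin n (MIS n) TwoCliqueGraphs T k →
                    (r : Forces g L c (MISRun T E m)) → ∀ f → AgreeOn (committed r) f (colouring r) →
                    (∀ u v → E u v ≡ adj (twoCliques f) u v) × m ≤ k
forcedRun-correct {E = E} {m} solves r f f≗g =
  solves (twoCliques f) (f , λ _ _ → refl) E m (proj₂ (consistent r f f≗g))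

misAdversary-commitsAll : ∀ {T : Tree (Subset n) (Subset n) (EdgeSet n)} {k g L c E m} → 2 ≤ n →
                          SolvesWithin n (MIS n) TwoCliqueGraphs T k →
                          (r : Forces g L c (MISRun T E m)) → ∀ z → z ∈ₗ committed r
misAdversary-commitsAll {E = E} 2≤n solves r z =
  decidable-stable (z ∈ₗ? committed r) λ z∉L →
    let w , w≢z = Fin-≢-exists 2≤n z
    in twoCliques-adj-flip g w≢z (trans (sym (reconstructs g (AgreeOn-refl _) w z))
                                        (reconstructs (updateAt g z not) (AgreeOn-updateAt g z∉L) w z))
  where
  g : Fin _ → Bool
  g = colouring r
  reconstructs : ∀ f → AgreeOn (committed r) f g → ∀ u v → E u v ≡ adj (twoCliques f) u v
  reconstructs f f≗g = proj₁ (forcedRun-correct solves r f f≗g)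

misLowerBound : ∀ n → 2 ≤ n → ∀ (T : Tree (Subset n) (Subset n) (EdgeSet n)) k →
                SolvesWithin n (MIS n) TwoCliqueGraphs T k → n ≤ 2 * k
misLowerBound n 2≤n T k solves with misAdversary T (const false) []
... | E , m , r = begin
  n                       ≤⟨ n≤length-of-cover (committed r) (misAdversary-commitsAll 2≤n solves r) ⟩
  length (committed r)    ≤⟨ growth r ⟩
  m * 2                   ≤⟨ *-monoˡ-≤ 2 m≤k ⟩
  k * 2                   ≡⟨ *-comm k 2 ⟩
  2 * k                   ∎
  where
  open ≤-Reasoning
  m≤k : m ≤ k
  m≤k = proj₂ (forcedRun-correct solves r (colouring r) (AgreeOn-refl _))

theorem14 : Σ GraphClass λ C →
    -- Ω(n) lower bound for MIS queries: every correct MIS algorithm with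
    -- worst-case cost k satisfies n ≤ d * k, for all n ≥ N₁
    (Σ ℕ λ d → Σ ℕ λ N₁ → ∀ n → N₁ ≤ n →
      ∀ (T : Tree (Subset n) (Subset n) (EdgeSet n)) (k : ℕ) →
      SolvesWithin n (MIS n) C T k → n ≤ d * k)
    ×
    -- O(log n) upper bound for CC queries
    (Σ ℕ λ c → Σ ℕ λ N₂ → ∀ n → N₂ ≤ n →
      Σ (Tree (Subset n) (CCAnswer n) (EdgeSet n)) λ T →
        SolvesWithin n (CC n) C T (c * ⌊log₂ n ⌋))
theorem14 =
  TwoCliqueGraphs ,
  (2 , 2 , misLowerBound) ,
  (1 , 2 , λ n 2≤n →
    ccReconstruct n , SolvesWithin-mono {C = TwoCliqueGraphs} (1≤log₂ 2≤n) ccReconstruct-solves)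
  where
  1≤log₂ : ∀ {n} → 2 ≤ n → 1 ≤ 1 * ⌊log₂ n ⌋
  1≤log₂ 2≤n = ≤-trans (⌊log₂⌋-mono-≤ 2≤n) (≤-reflexive (sym (*-identityˡ _)))
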